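{- Let $X=X_2=\{\circ,\bullet\}$. The two sets of tree patterns whose complements in $\mathcal{LT}_3(X)$ are $\{\circ(\bullet(1,3),2),\ \bullet(\circ(1,2),3)\}$ and $\{\bullet(\circ(1,3),2),\ \circ(\bullet(1,2),3)\}$ are Wilf equivalent to each other; for each $n\ge3$, the number of trees with $n$ leaves avoiding either of these sets is twice the number of alternating permutations in $S_{n-1}$.
   Context: Trees are planar rooted binary trees whose internal vertices are each labelled $\circ$ or $\bullet$ and whose leaves are labelled bijectively by $\{1,\dots,l\}$ so that, assigning to each internal vertex the minimum label of its descendant leaves, the left child of each internal vertex has a smaller assigned number than its right child. Notation: a leaf is its label, and $c(A,B)$ denotes the tree whose root is labelled $c\in\{\circ,\bullet\}$ with left subtree $A$ and right subtree $B$. $\mathcal{LT}_3(X)$ is the set of the $12$ such trees with three leaves. A subtree of $T$ is a subtree $S$ rooted at an internal vertex of $T$ such that for every internal vertex of $S$ both its children in $T$ are in $S$; its leaves carry the assigned integers and relabelling them order-preservingly by $1,\dots,l$ gives the standardisation $\mathrm{st}(S)$; $T$ avoids a set of patterns if no $\mathrm{st}(S)$ lies in the set. Two pattern sets are Wilf equivalent if for every $l$ the numbers of trees with $l$ leaves avoiding them coincide. An alternating permutation of length $m$ is a permutation $\sigma\in S_m$ with $\sigma(1)<\sigma(2)>\sigma(3)<\sigma(4)>\cdots$ (their number is the Euler zigzag number, the same as for the reverse alternation). -}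

module Defs where

open import Data.Nat using (ℕ; zero; suc; _+_; _*_; _∸_; _≤_; _<ᵇ_; _≡ᵇ_; _⊔_; _⊓_)
open import Data.Bool using (Bool; true; false; _∧_; not; T)
open import Data.List using (List; []; _∷_; _++_; length; concatMap; map; filter)
open import Data.Bool.ListAction using (all; any)
open import Data.List.Base using (upTo)
open import Data.Product using (Σ; _,_)
open import Relation.Nullary.Decidable using (Dec; yes; no)

data Col : Set where
  white : Col   -- ∘
  black : Col   -- •

_≡ᶜ_ : Col → Col → Bool
white ≡ᶜ white = true
black ≡ᶜ black = true
_ ≡ᶜ _ = false

-- Raw planar rooted binary trees: leaves carry a natural-number label,
-- internal vertices carry a colour.  node c A B  is  c(A,B).
data Tree : Set where
  leaf : ℕ → Tree
  node : Col → Tree → Tree → Tree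

leaves : Tree → List ℕ
leaves (leaf n) = n ∷ []
leaves (node _ a b) = leaves a ++ leaves b

-- assigned number of a vertex: minimum label of its descendant leaves
minLeaf : Tree → ℕ
minLeaf (leaf n) = n
minLeaf (node _ a b) = minLeaf a ⊓ minLeaf b

ordered : Tree → Bool
ordered (leaf _) = true
ordered (node _ a b) = (minLeaf a <ᵇ minLeaf b) ∧ (ordered a ∧ ordered b)

oneTo : ℕ → List ℕ
oneTo l = map suc (upTo l)

isPermOf : ℕ → List ℕ → Bool
isPermOf m xs = (length xs ≡ᵇ m) ∧ all (λ i → any (λ x → i ≡ᵇ x) xs) (oneTo m)

isLT : ℕ → Tree → Bool
isLT l t = isPermOf l (leaves t) ∧ ordered t

_≡ᵗ_ : Tree → Tree → Bool
leaf m ≡ᵗ leaf n = m ≡ᵇ n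
node c a b ≡ᵗ node d a' b' = (c ≡ᶜ d) ∧ ((a ≡ᵗ a') ∧ (b ≡ᵗ b'))
_ ≡ᵗ _ = false

-- Truncations of the tree below a vertex, the vertex itself either being cut
-- (becoming a leaf carrying its assigned number) or kept with both children.
truncations : Tree → List Tree
rootedSubtrees : Tree → List Tree
truncations t = leaf (minLeaf t) ∷ rootedSubtrees t
rootedSubtrees (leaf _) = []
rootedSubtrees (node c a b) =
  concatMap (λ p → map (λ q → node c p q) (truncations b)) (truncations a)

-- all subtrees S of T (rooted at an internal vertex of T, closed under
-- taking both children of internal vertices of S); leaves of S carry the
-- assigned integers of the corresponding vertices of T
subtrees : Tree → List Tree
subtrees (leaf _) = []
subtrees (node c a b) = rootedSubtrees (node c a b) ++ (subtrees a ++ subtrees b)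

-- order-preserving relabelling of leaf labels by 1..l
rank : List ℕ → ℕ → ℕ
rank ls x = suc (length (filter (λ y → Data.Nat._<?_ y x) ls))

relabel : (ℕ → ℕ) → Tree → Tree
relabel f (leaf n) = leaf (f n)
relabel f (node c a b) = node c (relabel f a) (relabel f b)

st : Tree → Tree
st s = relabel (rank (leaves s)) s

avoids : List Tree → Tree → Bool
avoids ps t = all (λ s → not (any (λ p → st s ≡ᵗ p) ps)) (subtrees t)

AvoidTrees : List Tree → ℕ → Set
AvoidTrees ps l = Σ Tree (λ t → T (isLT l t ∧ avoids ps t))

colours : List Col
colours = white ∷ black ∷ []

LT3 : List Tree
LT3 = concatMap (λ c → concatMap (λ d →
        node c (leaf 1) (node d (leaf 2) (leaf 3)) ∷
        node c (node d (leaf 1) (leaf 2)) (leaf 3) ∷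
        node c (node d (leaf 1) (leaf 3)) (leaf 2) ∷ []) colours) colours

complementLT3 : List Tree → List Tree
complementLT3 ex = filter (λ t → Data.Bool.Properties.T? (not (any (λ e → t ≡ᵗ e) ex))) LT3
  where import Data.Bool.Properties

patterns₁ : List Tree
patterns₁ = complementLT3
  (node white (node black (leaf 1) (leaf 3)) (leaf 2) ∷
   node black (node white (leaf 1) (leaf 2)) (leaf 3) ∷ [])

patterns₂ : List Tree
patterns₂ = complementLT3
  (node black (node white (leaf 1) (leaf 3)) (leaf 2) ∷
   node white (node black (leaf 1) (leaf 2)) (leaf 3) ∷ [])

altUp altDown : List ℕ → Bool
altUp (x ∷ y ∷ r) = (x <ᵇ y) ∧ altDown (y ∷ r)
altUp _ = true
altDown (x ∷ y ∷ r) = (y <ᵇ x) ∧ altUp (y ∷ r)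
altDown _ = true

AltPerms : ℕ → Set
AltPerms m = Σ (List ℕ) (λ xs → T (isPermOf m xs ∧ altUp xs))

-- Every right comb c(1, d(2, 3)) is forbidden, so in an avoiding tree every right child is a leaf:
-- the tree is a left comb, with the leaf 1 at the bottom and leaves r₁, r₂, … hanging to the right
-- of the spine, read from the top.  On a window c(d(1, x), y) of two consecutive spine vertices the
-- standardisation is c(d(1,2),3) or c(d(1,3),2), and each of these is admitted for exactly one
-- colouring, with c ≠ d.  So the colours alternate along the spine, the top colour fixes whether
-- r₁ − 1, r₂ − 1, … starts with an ascent or a descent, and that sequence is alternating: avoiding
-- trees with n leaves correspond to the alternating permutations of 1, …, n − 1 of either starting
-- direction, and complementation i ↦ n − i exchanges the two directions.  The second pattern set
-- is the first with ∘ and • exchanged, so both are handled at once.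
module Submission where

open import Defs
open import Data.Nat using (ℕ; _≤_; _*_; _∸_)
open import Data.Fin using (Fin)
open import Data.Product using (_×_; ∃-syntax)
open import Function.Bundles using (_↔_)

open import Data.Bool using (Bool; true; false; _∧_; not; T; if_then_else_)
open import Data.Bool.ListAction using (any)
open import Data.Bool.Properties using (T-∧; T-≡; T-irrelevant)
open import Data.Empty using (⊥; ⊥-elim)
open import Data.Fin.Properties using (0↔⊥; 1↔⊤; +↔⊎)
open import Data.List using (List; []; _∷_; _++_; length; map; reverse; upTo; cartesianProductWith)
open import Data.List.Membership.DecPropositional using (_∈?_)
open import Data.List.Membership.Propositional using (_∈_; _∉_; _─_; find)
open import Data.List.Membership.Propositional.Properties
  using (∉[]; ∈-++⁺ˡ; ∈-++⁺ʳ; ∈-++⁻; ∈-map⁺; ∈-map⁻; ∈-upTo⁺; ∈-upTo⁻;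
         ∈-cartesianProductWith⁺; ∈-concatMap⁻)
open import Data.List.Properties
  using (≡-dec; length-++; length-map; length-reverse; length-upTo; length-removeAt′; unfold-reverse; map-applyUpTo;
         map-∘; map-id-local; filter-accept; filter-reject)
open import Data.List.Relation.Binary.Subset.Propositional using (_⊆_)
open import Data.List.Relation.Unary.All using (All; []; _∷_)
import Data.List.Relation.Unary.All as All
open import Data.List.Relation.Unary.All.Properties
  using (─⁺; ++⁺; ++⁻ˡ; All¬⇒¬Any; ¬Any⇒All¬; all⁺; all⁻; all-anti-mono)
open import Data.List.Relation.Unary.AllPairs using ([]; _∷_)
open import Data.List.Relation.Unary.Any using (here; there)
import Data.List.Relation.Unary.Any as Any
open import Data.List.Relation.Unary.Any.Properties using (any⁺; any⁻; reverse⁺; reverse⁻)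
open import Data.List.Relation.Unary.Unique.Propositional using (Unique)
import Data.List.Relation.Unary.Unique.Propositional.Properties as Unique
open import Data.Nat using (zero; suc; pred; z≤n; s≤s; _<_; _+_; _≡ᵇ_; _<ᵇ_; _<?_; >-nonZero)
open import Data.Nat.Properties
  using (_≟_; suc-injective; ≡ᵇ⇒≡; ≡⇒≡ᵇ; <ᵇ⇒<; <⇒<ᵇ; ≤-refl; ≤-trans; ≤-reflexive; ≤-antisym; ≤-pred;
         <-irrefl; <-trans; <-cmp; <⇒≤; <⇒≯; >⇒≢; n≮n; n≮0; m≤m+n; m≤n⇒m≤1+n; +-comm; +-mono-≤; +-identityʳ;
         m⊓n≤m; m⊓n≤n; ⊓-sel; m≤n⇒m⊓n≡m; m∸n≤m; ∸-monoʳ-<; m∸[m∸n]≡n; m<n⇒0<n∸m; suc-pred; pred-mono-<)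
open import Data.Product using (Σ; _,_; proj₁; proj₂)
open import Data.Sum using (_⊎_; inj₁; inj₂)
open import Data.Sum.Function.Propositional using (_⊎-↔_)
open import Data.Unit using (tt)
open import Function using (_∘_; _$_)
open import Function.Bundles using (Equivalence; _⇔_; mk⇔; mk↔ₛ′)
open import Function.Properties.Inverse using (↔-refl; ↔-sym; ↔-trans)
open import Relation.Binary.Definitions using (DecidableEquality; Tri; tri<; tri≈; tri>)
open import Relation.Binary.PropositionalEquality
  using (_≡_; _≢_; refl; sym; trans; cong; cong₂; subst; module ≡-Reasoning)
open import Relation.Nullary.Decidable using (Dec; yes; no; ⌊_⌋; fromWitnessFalse; toWitnessFalse; from-yes)
open import Relation.Nullary.Negation using (¬_)

open ≡-Reasoning

-- Finite decidable subsets

Σ-T-≡ : {A : Set} {P : A → Bool} {x y : A} {p : T (P x)} {q : T (P y)} →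
        x ≡ y → _≡_ {A = Σ A (T ∘ P)} (x , p) (y , q)
Σ-T-≡ {x = x} refl = cong (x ,_) (T-irrelevant _ _)

T↔Fin : (b : Bool) → T b ↔ Fin (if b then 1 else 0)
T↔Fin true  = ↔-sym 1↔⊤
T↔Fin false = ↔-sym 0↔⊥

module _ {A : Set} (_≟_ : DecidableEquality A) where

  without : (A → Bool) → A → A → Bool
  without P y x = P x ∧ not ⌊ x ≟ y ⌋

  Σ-T-split : (P : A → Bool) (y : A) → Σ A (T ∘ P) ↔ (T (P y) ⊎ Σ A (T ∘ without P y))
  Σ-T-split P y = mk↔ₛ′ to from to∘from from∘to
    where
    classify : ∀ x → T (P x) → Dec (x ≡ y) → T (P y) ⊎ Σ A (T ∘ without P y)
    classify x px (yes refl) = inj₁ px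
    classify x px (no x≢y)   = inj₂ (x , Equivalence.from T-∧ (px , fromWitnessFalse x≢y))

    to : Σ A (T ∘ P) → T (P y) ⊎ Σ A (T ∘ without P y)
    to (x , px) = classify x px (x ≟ y)

    from : T (P y) ⊎ Σ A (T ∘ without P y) → Σ A (T ∘ P)
    from (inj₁ py)      = y , py
    from (inj₂ (x , q)) = x , proj₁ (Equivalence.to (T-∧ {P x}) q)

    to∘from : ∀ z → to (from z) ≡ z
    to∘from (inj₁ py) with y ≟ y
    ... | yes refl = refl
    ... | no y≢y   = ⊥-elim (y≢y refl)
    to∘from (inj₂ (x , q)) = classify-other (x ≟ y)
      where
      classify-other : (d : Dec (x ≡ y)) → classify x (proj₁ (Equivalence.to (T-∧ {P x}) q)) d ≡ inj₂ (x , q)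
      classify-other (yes x≡y) = ⊥-elim (toWitnessFalse (proj₂ (Equivalence.to (T-∧ {P x}) q)) x≡y)
      classify-other (no _)    = cong inj₂ (Σ-T-≡ refl)

    from∘to : ∀ z → from (to z) ≡ z
    from∘to (x , px) with x ≟ y
    ... | yes refl = refl
    ... | no _     = Σ-T-≡ refl

  finite-subset : (P : A → Bool) (xs : List A) → (∀ x → T (P x) → x ∈ xs) →
                  ∃[ k ] (Σ A (T ∘ P) ↔ Fin k)
  finite-subset P [] covered = 0 , mk↔ₛ′ (λ { (x , px) → ⊥-elim (∉[] (covered x px)) }) (λ ()) (λ ())
                                        (λ { (x , px) → ⊥-elim (∉[] (covered x px)) })
  finite-subset P (y ∷ xs) covered =
    let _ , rest = finite-subset (without P y) xs covered′
    in  _ , ↔-trans (Σ-T-split P y) (↔-trans (T↔Fin (P y) ⊎-↔ rest) (↔-sym +↔⊎))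
    where
    covered′ : ∀ x → T (without P y x) → x ∈ xs
    covered′ x q with Equivalence.to (T-∧ {P x}) q
    ... | px , x≢y with covered x px
    ...   | here x≡y = ⊥-elim (toWitnessFalse x≢y x≡y)
    ...   | there x∈ = x∈

module _ {A : Set} where

  ∈-─⁻ : ∀ {x y} (xs : List A) (p : x ∈ xs) → y ∈ xs ─ p → y ∈ xs
  ∈-─⁻ (_ ∷ _)  (here _)  y∈        = there y∈
  ∈-─⁻ (_ ∷ _)  (there p) (here y≡) = here y≡
  ∈-─⁻ (_ ∷ xs) (there p) (there y∈) = there (∈-─⁻ xs p y∈)

  ∈-─⁺ : ∀ {x y} (xs : List A) (p : x ∈ xs) → y ∈ xs → y ≢ x → y ∈ xs ─ p
  ∈-─⁺ (_ ∷ _)  (here refl) (here refl) y≢x = ⊥-elim (y≢x refl)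
  ∈-─⁺ (_ ∷ _)  (here _)    (there y∈)  _   = y∈
  ∈-─⁺ (_ ∷ _)  (there p)   (here y≡)   _   = here y≡
  ∈-─⁺ (_ ∷ xs) (there p)   (there y∈)  y≢x = there (∈-─⁺ xs p y∈ y≢x)

  Unique-─ : ∀ {x} {xs : List A} (p : x ∈ xs) → Unique xs → Unique (xs ─ p)
  Unique-─ (here _)  (_ ∷ u)      = u
  Unique-─ (there p) (x≢xs ∷ u)   = ─⁺ p x≢xs ∷ Unique-─ p u

  ∉-─ : ∀ {x} {xs : List A} (p : x ∈ xs) → Unique xs → x ∉ xs ─ p
  ∉-─ (here refl) (x≢xs ∷ _) x∈       = All¬⇒¬Any x≢xs x∈
  ∉-─ (there p)   (y≢xs ∷ _) (here refl) = All¬⇒¬Any y≢xs p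
  ∉-─ (there p)   (_ ∷ u)    (there x∈) = ∉-─ p u x∈

  Unique-++⁻ˡ : (xs : List A) {ys : List A} → Unique (xs ++ ys) → Unique xs
  Unique-++⁻ˡ []       _          = []
  Unique-++⁻ˡ (_ ∷ xs) (x≢ ∷ u)   = ++⁻ˡ xs x≢ ∷ Unique-++⁻ˡ xs u

  Unique-++⇒∉ : (xs : List A) {ys : List A} {x : A} → Unique (xs ++ ys) → x ∈ xs → x ∉ ys
  Unique-++⇒∉ (_ ∷ xs) (x≢ ∷ _) (here refl) x∈ys = All¬⇒¬Any x≢ (∈-++⁺ʳ xs x∈ys)
  Unique-++⇒∉ (_ ∷ xs) (_ ∷ u)  (there x∈)  = Unique-++⇒∉ xs u x∈

  Unique-⊆⇒length≤ : {ys xs : List A} → Unique ys → ys ⊆ xs → length ys ≤ length xs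
  Unique-⊆⇒length≤ {[]}     _            _   = z≤n
  Unique-⊆⇒length≤ {y ∷ ys} {xs} (y≢ys ∷ u) ys⊆xs =
    ≤-trans (s≤s (Unique-⊆⇒length≤ u ys⊆xs─y)) (≤-reflexive (sym (length-removeAt′ xs _)))
    where
    y∈xs : y ∈ xs
    y∈xs = ys⊆xs (here refl)
    ys⊆xs─y : ys ⊆ xs ─ y∈xs
    ys⊆xs─y {z} z∈ys = ∈-─⁺ xs y∈xs (ys⊆xs (there z∈ys)) λ { refl → All¬⇒¬Any y≢ys z∈ys }

  module _ (_≟_ : DecidableEquality A) where

    Unique-⊆-length≥⇒Unique-⊇ : {ys xs : List A} → Unique ys → ys ⊆ xs → length xs ≤ length ys →
                                Unique xs × xs ⊆ ys
    Unique-⊆-length≥⇒Unique-⊇ {ys} {[]} _ _ _ = [] , λ ()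
    Unique-⊆-length≥⇒Unique-⊇ {ys} {x ∷ xs} u ys⊆ |x∷xs|≤ with _∈?_ _≟_ x ys
    ... | no x∉ys = ⊥-elim (<-irrefl refl (≤-trans |x∷xs|≤ (Unique-⊆⇒length≤ u ys⊆xs)))
      where
      ys⊆xs : ys ⊆ xs
      ys⊆xs z∈ with ys⊆ z∈
      ... | here refl = ⊥-elim (x∉ys z∈)
      ... | there z∈xs = z∈xs
    ... | yes x∈ys = ¬Any⇒All¬ xs (∉-─ x∈ys u ∘ proj₂ ih) ∷ proj₁ ih , x∷xs⊆ys
      where
      ys─x⊆xs : ys ─ x∈ys ⊆ xs
      ys─x⊆xs z∈ with ys⊆ (∈-─⁻ ys x∈ys z∈)
      ... | here refl = ⊥-elim (∉-─ x∈ys u z∈)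
      ... | there z∈xs = z∈xs
      ih : Unique xs × xs ⊆ ys ─ x∈ys
      ih = Unique-⊆-length≥⇒Unique-⊇ (Unique-─ x∈ys u) ys─x⊆xs
             (≤-pred (≤-trans |x∷xs|≤ (≤-reflexive (length-removeAt′ ys _))))
      x∷xs⊆ys : x ∷ xs ⊆ ys
      x∷xs⊆ys (here refl) = x∈ys
      x∷xs⊆ys (there z∈)  = ∈-─⁻ ys x∈ys (proj₂ ih z∈)

listsOver : {A : Set} → ℕ → List A → List (List A)
listsOver zero    _  = [] ∷ []
listsOver (suc k) es = cartesianProductWith _∷_ es (listsOver k es)

∈-listsOver : {A : Set} {es xs : List A} → xs ⊆ es → xs ∈ listsOver (length xs) es
∈-listsOver {xs = []}     _      = here refl
∈-listsOver {xs = x ∷ xs} x∷xs⊆ =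
  ∈-cartesianProductWith⁺ _∷_ (x∷xs⊆ (here refl)) (∈-listsOver (x∷xs⊆ ∘ there))

-- Permutations of 1, …, m

oneTo-suc : ∀ m → oneTo (suc m) ≡ 1 ∷ map suc (oneTo m)
oneTo-suc m = cong (λ js → 1 ∷ map suc js) (sym (map-applyUpTo (λ j → j) suc m))

∈-oneTo⁻ : ∀ {m i} → i ∈ oneTo m → 1 ≤ i × i ≤ m
∈-oneTo⁻ i∈ with ∈-map⁻ suc i∈
... | _ , j∈ , refl = s≤s z≤n , ∈-upTo⁻ j∈

∈-oneTo⁺ : ∀ {m i} → 1 ≤ i → i ≤ m → i ∈ oneTo m
∈-oneTo⁺ {i = suc _} _ i≤m = ∈-map⁺ suc (∈-upTo⁺ i≤m)

length-oneTo : ∀ m → length (oneTo m) ≡ m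
length-oneTo m = trans (length-map suc (upTo m)) (length-upTo m)

Unique-oneTo : ∀ m → Unique (oneTo m)
Unique-oneTo m = Unique.map⁺ suc-injective (Unique.upTo⁺ m)

IsPerm : ℕ → List ℕ → Set
IsPerm m xs = length xs ≡ m × oneTo m ⊆ xs

isPermOf⇔IsPerm : ∀ {m xs} → T (isPermOf m xs) ⇔ IsPerm m xs
isPermOf⇔IsPerm {m} {xs} = mk⇔ to from
  where
  to : T (isPermOf m xs) → IsPerm m xs
  to t with Equivalence.to (T-∧ {length xs ≡ᵇ m}) t
  ... | |xs|≡ᵇm , covered =
    ≡ᵇ⇒≡ _ _ |xs|≡ᵇm , λ i∈ → Any.map (≡ᵇ⇒≡ _ _) (any⁻ _ xs (All.lookup (all⁺ _ (oneTo m) covered) i∈))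
  from : IsPerm m xs → T (isPermOf m xs)
  from (|xs|≡m , covered) = Equivalence.from T-∧
    (≡⇒≡ᵇ _ _ |xs|≡m , all⁻ _ (All.tabulate λ i∈ → any⁺ _ (Any.map (≡⇒≡ᵇ _ _) (covered i∈))))

IsPerm⇒Unique×⊆oneTo : ∀ {m xs} → IsPerm m xs → Unique xs × xs ⊆ oneTo m
IsPerm⇒Unique×⊆oneTo {m} (|xs|≡m , covered) =
  Unique-⊆-length≥⇒Unique-⊇ _≟_ (Unique-oneTo m) covered (≤-reflexive (trans |xs|≡m (sym (length-oneTo m))))

IsPerm⇒positive : ∀ {m xs} → IsPerm m xs → All (1 ≤_) xs
IsPerm⇒positive perm = All.tabulate (proj₁ ∘ ∈-oneTo⁻ ∘ proj₂ (IsPerm⇒Unique×⊆oneTo perm))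

IsPerm-1∷reverse-map-suc : ∀ {m xs} → IsPerm (suc m) (1 ∷ reverse (map suc xs)) ⇔ IsPerm m xs
IsPerm-1∷reverse-map-suc {m} {xs} = mk⇔ to from
  where
  length-shifted : length (reverse (map suc xs)) ≡ length xs
  length-shifted = trans (length-reverse (map suc xs)) (length-map suc xs)

  to : IsPerm (suc m) (1 ∷ reverse (map suc xs)) → IsPerm m xs
  to (|ys|≡ , covered) = suc-injective (trans (cong suc (sym length-shifted)) |ys|≡) , covered′
    where
    covered′ : oneTo m ⊆ xs
    covered′ {j} j∈ with covered (subst (suc j ∈_) (sym (oneTo-suc m)) (there (∈-map⁺ suc j∈)))
    ... | here refl = ⊥-elim (<-irrefl refl (proj₁ (∈-oneTo⁻ j∈)))
    ... | there sj∈ with ∈-map⁻ suc (reverse⁻ sj∈)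
    ...   | _ , k∈ , refl = k∈

  from : IsPerm m xs → IsPerm (suc m) (1 ∷ reverse (map suc xs))
  from (|xs|≡m , covered) =
    cong suc (trans length-shifted |xs|≡m) , λ {i} i∈ → covered′ (subst (i ∈_) (oneTo-suc m) i∈)
    where
    covered′ : 1 ∷ map suc (oneTo m) ⊆ 1 ∷ reverse (map suc xs)
    covered′ (here refl) = here refl
    covered′ (there i∈) with ∈-map⁻ suc i∈
    ... | _ , j∈ , refl = there (reverse⁺ (∈-map⁺ suc (covered j∈)))

-- Alternating permutations

zigzag : Bool → List ℕ → Bool
zigzag true  = altUp
zigzag false = altDown

inOrder : Bool → ℕ → ℕ → Bool
inOrder true  x y = x <ᵇ y
inOrder false x y = y <ᵇ x

zigzag-∷∷ : ∀ b {x y zs} → T (zigzag b (x ∷ y ∷ zs)) ⇔ (T (inOrder b x y) × T (zigzag (not b) (y ∷ zs)))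
zigzag-∷∷ true  = T-∧
zigzag-∷∷ false = T-∧

zigzag-[] : ∀ b → T (zigzag b [])
zigzag-[] true  = _
zigzag-[] false = _

zigzag-[x] : ∀ b x → T (zigzag b (x ∷ []))
zigzag-[x] true  _ = _
zigzag-[x] false _ = _

zigzag-tail : ∀ b x xs → T (zigzag b (x ∷ xs)) → T (zigzag (not b) xs)
zigzag-tail b x []       _ = zigzag-[] (not b)
zigzag-tail b x (y ∷ xs) t = proj₂ (Equivalence.to (zigzag-∷∷ b) t)

inOrder-antitone : ∀ b {x y} (f : ℕ → ℕ) → (x < y → f y < f x) → (y < x → f x < f y) →
                   T (inOrder b x y) → T (inOrder (not b) (f x) (f y))
inOrder-antitone true  f x<y⇒ _ t = <⇒<ᵇ (x<y⇒ (<ᵇ⇒< _ _ t))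
inOrder-antitone false f _ y<x⇒ t = <⇒<ᵇ (y<x⇒ (<ᵇ⇒< _ _ t))

Antitone-on : (ℕ → ℕ) → List ℕ → Set
Antitone-on f xs = ∀ {x y} → x ∈ xs → y ∈ xs → x < y → f y < f x

zigzag-map-antitone : ∀ b (f : ℕ → ℕ) xs → Antitone-on f xs → T (zigzag b xs) → T (zigzag (not b) (map f xs))
zigzag-map-antitone b     f []           _ _ = zigzag-[] (not b)
zigzag-map-antitone b     f (x ∷ [])     _ _ = zigzag-[x] (not b) (f x)
zigzag-map-antitone b     f (x ∷ y ∷ zs) f↓ t =
  let xy , rest = Equivalence.to (zigzag-∷∷ b) t
  in  Equivalence.from (zigzag-∷∷ (not b))
        ( inOrder-antitone b f (f↓ (here refl) (there (here refl))) (f↓ (there (here refl)) (here refl)) xy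
        , zigzag-map-antitone (not b) f (y ∷ zs) (λ x∈ y∈ → f↓ (there x∈) (there y∈)) rest )

complement : ℕ → ℕ → ℕ
complement m x = suc m ∸ x

complement-oneTo : ∀ {m i} → i ∈ oneTo m → complement m i ∈ oneTo m
complement-oneTo {m} {i} i∈ with ∈-oneTo⁻ {m} {i} i∈
... | s≤s {n = k} _ , i≤m = ∈-oneTo⁺ (m<n⇒0<n∸m (s≤s i≤m)) (m∸n≤m m k)

complement-involutive : ∀ {m i} → i ∈ oneTo m → complement m (complement m i) ≡ i
complement-involutive {m} {i} i∈ = m∸[m∸n]≡n (m≤n⇒m≤1+n (proj₂ (∈-oneTo⁻ {m} {i} i∈)))

complement-antitone : ∀ {m xs} → xs ⊆ oneTo m → Antitone-on (complement m) xs
complement-antitone xs⊆ _ y∈ x<y = ∸-monoʳ-< x<y (m≤n⇒m≤1+n (proj₂ (∈-oneTo⁻ (xs⊆ y∈))))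

IsPerm-map-complement : ∀ {m xs} → IsPerm m xs → IsPerm m (map (complement m) xs)
IsPerm-map-complement {m} {xs} (|xs|≡m , covered) = trans (length-map _ xs) |xs|≡m , covered′
  where
  covered′ : oneTo m ⊆ map (complement m) xs
  covered′ {i} i∈ = subst (_∈ map (complement m) xs) (complement-involutive i∈)
                          (∈-map⁺ (complement m) (covered (complement-oneTo i∈)))

ZigzagPerms : Bool → ℕ → Set
ZigzagPerms b m = Σ (List ℕ) (λ xs → T (isPermOf m xs ∧ zigzag b xs))

ZigzagPerms⁻ : ∀ b m ((xs , _) : ZigzagPerms b m) → IsPerm m xs × T (zigzag b xs)
ZigzagPerms⁻ b m (xs , h) with Equivalence.to (T-∧ {isPermOf m xs}) h
... | perm , zz = Equivalence.to isPermOf⇔IsPerm perm , zz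

ZigzagPerms⇒⊆oneTo : ∀ b m ((xs , _) : ZigzagPerms b m) → xs ⊆ oneTo m
ZigzagPerms⇒⊆oneTo b m z = proj₂ (IsPerm⇒Unique×⊆oneTo (proj₁ (ZigzagPerms⁻ b m z)))

Σ-ZigzagPerms-≡ : ∀ {m b b′ xs xs′} {h : T (isPermOf m xs ∧ zigzag b xs)} {h′ : T (isPermOf m xs′ ∧ zigzag b′ xs′)} →
                  b ≡ b′ → xs ≡ xs′ →
                  _≡_ {A = Σ Bool (λ b → ZigzagPerms b m)} (b , xs , h) (b′ , xs′ , h′)
Σ-ZigzagPerms-≡ {b = b} {xs = xs} refl refl = cong (λ h → b , xs , h) (T-irrelevant _ _)

complement-ZigzagPerms : ∀ b {m} → ZigzagPerms b m → ZigzagPerms (not b) m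
complement-ZigzagPerms b {m} z@(xs , _) with ZigzagPerms⁻ b m z
... | perm , zz = map (complement m) xs , Equivalence.from T-∧
  ( Equivalence.from isPermOf⇔IsPerm (IsPerm-map-complement perm)
  , zigzag-map-antitone b (complement m) xs (complement-antitone (ZigzagPerms⇒⊆oneTo b m z)) zz )

map-complement-involutive : ∀ {m xs} → xs ⊆ oneTo m → map (complement m) (map (complement m) xs) ≡ xs
map-complement-involutive {xs = xs} xs⊆ =
  trans (sym (map-∘ xs)) (map-id-local (All.tabulate (complement-involutive ∘ xs⊆)))

ZigzagPerms-up↔down : ∀ m → ZigzagPerms true m ↔ ZigzagPerms false m
ZigzagPerms-up↔down m =
  mk↔ₛ′ (complement-ZigzagPerms true) (complement-ZigzagPerms false)
        (λ z → Σ-T-≡ (complement²≡id false z)) (λ z → Σ-T-≡ (complement²≡id true z))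
  where
  complement²≡id : ∀ b (z : ZigzagPerms b m) →
                   proj₁ (complement-ZigzagPerms (not b) (complement-ZigzagPerms b z)) ≡ proj₁ z
  complement²≡id b z = map-complement-involutive (ZigzagPerms⇒⊆oneTo b m z)

finite-ZigzagPerms : ∀ b m → ∃[ a ] (ZigzagPerms b m ↔ Fin a)
finite-ZigzagPerms b m = finite-subset (≡-dec _≟_) _ (listsOver m (oneTo m)) listed
  where
  listed : ∀ xs → T (isPermOf m xs ∧ zigzag b xs) → xs ∈ listsOver m (oneTo m)
  listed xs h with proj₁ (ZigzagPerms⁻ b m (xs , h))
  ... | refl , _ = ∈-listsOver (ZigzagPerms⇒⊆oneTo b m (xs , h))

-- Trees and their standardisation

size : Tree → ℕ
size t = length (leaves t)

size-node : ∀ c a b → size (node c a b) ≡ size a + size b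
size-node c a b = length-++ (leaves a)

1≤size : ∀ t → 1 ≤ size t
1≤size (leaf _)     = s≤s z≤n
1≤size (node c a b) = ≤-trans (1≤size a) (≤-trans (m≤m+n (size a) (size b)) (≤-reflexive (sym (size-node c a b))))

size-relabel : ∀ f t → size (relabel f t) ≡ size t
size-relabel f (leaf _)     = refl
size-relabel f (node c a b) = begin
  size (relabel f (node c a b))         ≡⟨ size-node c (relabel f a) (relabel f b) ⟩
  size (relabel f a) + size (relabel f b) ≡⟨ cong₂ _+_ (size-relabel f a) (size-relabel f b) ⟩
  size a + size b                       ≡⟨ sym (size-node c a b) ⟩
  size (node c a b)                     ∎

node-cong : ∀ {c d a a′ b b′} → c ≡ d → a ≡ a′ → b ≡ b′ → node c a b ≡ node d a′ b′
node-cong refl refl refl = refl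

≡ᶜ⇒≡ : ∀ {c d} → T (c ≡ᶜ d) → c ≡ d
≡ᶜ⇒≡ {white} {white} _ = refl
≡ᶜ⇒≡ {black} {black} _ = refl

≡ᵗ⇒≡ : ∀ {u v} → T (u ≡ᵗ v) → u ≡ v
≡ᵗ⇒≡ {leaf m}     {leaf n}       t = cong leaf (≡ᵇ⇒≡ m n t)
≡ᵗ⇒≡ {node c a b} {node d a′ b′} t with Equivalence.to (T-∧ {c ≡ᶜ d}) t
... | c≡d , t′ with Equivalence.to (T-∧ {a ≡ᵗ a′}) t′
...   | a≡a′ , b≡b′ = node-cong (≡ᶜ⇒≡ c≡d) (≡ᵗ⇒≡ a≡a′) (≡ᵗ⇒≡ b≡b′)

minLeaf-≤ : ∀ t {x} → x ∈ leaves t → minLeaf t ≤ x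
minLeaf-≤ (leaf _)     (here refl) = ≤-refl
minLeaf-≤ (node c a b) x∈ with ∈-++⁻ (leaves a) x∈
... | inj₁ x∈a = ≤-trans (m⊓n≤m (minLeaf a) (minLeaf b)) (minLeaf-≤ a x∈a)
... | inj₂ x∈b = ≤-trans (m⊓n≤n (minLeaf a) (minLeaf b)) (minLeaf-≤ b x∈b)

minLeaf-∈ : ∀ t → minLeaf t ∈ leaves t
minLeaf-∈ (leaf _)     = here refl
minLeaf-∈ (node c a b) with ⊓-sel (minLeaf a) (minLeaf b)
... | inj₁ ≡a = subst (_∈ leaves (node c a b)) (sym ≡a) (∈-++⁺ˡ (minLeaf-∈ a))
... | inj₂ ≡b = subst (_∈ leaves (node c a b)) (sym ≡b) (∈-++⁺ʳ (leaves a) (minLeaf-∈ b))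

rootedSubtree-node : ∀ {p} t → p ∈ rootedSubtrees t → ∃[ c ] ∃[ a ] ∃[ b ] p ≡ node c a b
rootedSubtree-node (node c a b) p∈ with find (∈-concatMap⁻ (λ q → map (node c q) (truncations b)) {xs = truncations a} p∈)
... | q , _ , p∈map with ∈-map⁻ (node c q) p∈map
...   | r , _ , refl = c , q , r , refl

leaf∈truncations : ∀ {n} t → leaf n ∈ truncations t → n ≡ minLeaf t
leaf∈truncations t (here refl) = refl
leaf∈truncations t (there n∈) with rootedSubtree-node t n∈
... | _ , _ , _ , ()

size-leftComb : ∀ c d q m n → size (node c (node d q (leaf m)) (leaf n)) ≡ 2 + size q
size-leftComb c d q m n = begin
  size (node c (node d q (leaf m)) (leaf n)) ≡⟨ size-node c (node d q (leaf m)) (leaf n) ⟩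
  size (node d q (leaf m)) + 1               ≡⟨ cong (_+ 1) (size-node d q (leaf m)) ⟩
  (size q + 1) + 1                           ≡⟨ +-comm (size q + 1) 1 ⟩
  suc (size q + 1)                           ≡⟨ cong suc (+-comm (size q) 1) ⟩
  2 + size q                                 ∎

2≤size-node : ∀ c a b → 2 ≤ size (node c a b)
2≤size-node c a b = ≤-trans (+-mono-≤ (1≤size a) (1≤size b)) (≤-reflexive (sym (size-node c a b)))

AvoidTree⁻ : ∀ ps m t → T (isLT m t ∧ avoids ps t) → IsPerm m (leaves t) × T (ordered t) × T (avoids ps t)
AvoidTree⁻ ps m t h with Equivalence.to (T-∧ {isLT m t}) h
... | lt , av with Equivalence.to (T-∧ {isPermOf m (leaves t)}) lt
...   | perm , o = Equivalence.to isPermOf⇔IsPerm perm , o , av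

ordered-node⁻ : ∀ c a b → T (ordered (node c a b)) → minLeaf a < minLeaf b × T (ordered a) × T (ordered b)
ordered-node⁻ c a b o with Equivalence.to (T-∧ {minLeaf a <ᵇ minLeaf b}) o
... | a<b , oab = <ᵇ⇒< _ _ a<b , Equivalence.to (T-∧ {ordered a}) oab

minLeaf-node : ∀ c a b → minLeaf a < minLeaf b → minLeaf (node c a b) ≡ minLeaf a
minLeaf-node c a b a<b = m≤n⇒m⊓n≡m (<⇒≤ a<b)

rank-accept : ∀ {a v} ls → a < v → rank (a ∷ ls) v ≡ suc (rank ls v)
rank-accept {v = v} ls a<v = cong (suc ∘ length) (filter-accept (_<? v) {xs = ls} a<v)

rank-reject : ∀ {a v} ls → ¬ a < v → rank (a ∷ ls) v ≡ rank ls v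
rank-reject {v = v} ls a≮v = cong (suc ∘ length) (filter-reject (_<? v) {xs = ls} a≮v)

module _ {x y z : ℕ} (x<y : x < y) (y<z : y < z) where

  private
    x<z : x < z
    x<z = <-trans x<y y<z

  ranks-xyz : rank (x ∷ y ∷ z ∷ []) x ≡ 1 × rank (x ∷ y ∷ z ∷ []) y ≡ 2 × rank (x ∷ y ∷ z ∷ []) z ≡ 3
  ranks-xyz
    rewrite rank-reject (y ∷ z ∷ []) (n≮n x) | rank-reject (z ∷ []) (<⇒≯ x<y) | rank-reject [] (<⇒≯ x<z)
          | rank-accept (y ∷ z ∷ []) x<y | rank-reject (z ∷ []) (n≮n y) | rank-reject [] (<⇒≯ y<z)
          | rank-accept (y ∷ z ∷ []) x<z | rank-accept (z ∷ []) y<z | rank-reject [] (n≮n z) = refl , refl , refl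

  ranks-xzy : rank (x ∷ z ∷ y ∷ []) x ≡ 1 × rank (x ∷ z ∷ y ∷ []) z ≡ 3 × rank (x ∷ z ∷ y ∷ []) y ≡ 2
  ranks-xzy
    rewrite rank-reject (z ∷ y ∷ []) (n≮n x) | rank-reject (y ∷ []) (<⇒≯ x<z) | rank-reject [] (<⇒≯ x<y)
          | rank-accept (z ∷ y ∷ []) x<z | rank-reject (y ∷ []) (n≮n z) | rank-accept [] y<z
          | rank-accept (z ∷ y ∷ []) x<y | rank-reject (y ∷ []) (<⇒≯ y<z) | rank-reject [] (n≮n y) = refl , refl , refl

  st-rightComb : ∀ c d → st (node c (leaf x) (node d (leaf y) (leaf z))) ≡ node c (leaf 1) (node d (leaf 2) (leaf 3))
  st-rightComb c d with ranks-xyz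
  ... | r₁ , r₂ , r₃ rewrite r₁ | r₂ | r₃ = refl

  st-leftComb₁₂ : ∀ c d → st (node c (node d (leaf x) (leaf y)) (leaf z)) ≡ node c (node d (leaf 1) (leaf 2)) (leaf 3)
  st-leftComb₁₂ c d with ranks-xyz
  ... | r₁ , r₂ , r₃ rewrite r₁ | r₂ | r₃ = refl

  st-leftComb₁₃ : ∀ c d → st (node c (node d (leaf x) (leaf z)) (leaf y)) ≡ node c (node d (leaf 1) (leaf 3)) (leaf 2)
  st-leftComb₁₃ c d with ranks-xzy
  ... | r₁ , r₃ , r₂ rewrite r₁ | r₃ | r₂ = refl

-- The two pattern sets, differing by the exchange of ∘ and •

swapIf : Bool → Col → Col
swapIf false c     = c
swapIf true  white = black
swapIf true  black = white

patternsOf : Bool → List Tree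
patternsOf s = complementLT3
  (node (swapIf s white) (node (swapIf s black) (leaf 1) (leaf 3)) (leaf 2) ∷
   node (swapIf s black) (node (swapIf s white) (leaf 1) (leaf 2)) (leaf 3) ∷ [])

-- The colour forced on a spine vertex whose right leaf is smaller (true) or larger (false) than
-- that of the spine vertex below it.
colourOf : Bool → Bool → Col
colourOf s true  = swapIf s white
colourOf s false = swapIf s black

direction : Bool → Col → Bool
direction s c = c ≡ᶜ swapIf s white

colourOf-direction : ∀ s c → colourOf s (direction s c) ≡ c
colourOf-direction false white = refl
colourOf-direction false black = refl
colourOf-direction true  white = refl
colourOf-direction true  black = refl

direction-colourOf : ∀ s b → direction s (colourOf s b) ≡ b
direction-colourOf false true  = refl
direction-colourOf false false = refl
direction-colourOf true  true  = refl
direction-colourOf true  false = refl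

admits : List Tree → Tree → Bool
admits ps p = not (any (p ≡ᵗ_) ps)

avoids⇒admits : ∀ ps t {p} → T (avoids ps t) → p ∈ subtrees t → T (admits ps (st p))
avoids⇒admits ps t av = All.lookup (all⁺ (admits ps ∘ st) (subtrees t) av)

size-patternsOf : ∀ s → All (λ p → size p ≡ 3) (patternsOf s)
size-patternsOf false = from-yes (All.all? (λ p → size p ≟ 3) (patternsOf false))
size-patternsOf true  = from-yes (All.all? (λ p → size p ≟ 3) (patternsOf true))

admits-size≢3 : ∀ s t → size t ≢ 3 → T (admits (patternsOf s) (st t))
admits-size≢3 s t size≢3 with any (st t ≡ᵗ_) (patternsOf s) in matched
... | false = _
... | true  = ⊥-elim (size≢3 (trans (sym (size-relabel _ t)) (All.lookup (size-patternsOf s) st∈)))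
  where
  st∈ : st t ∈ patternsOf s
  st∈ = Any.map ≡ᵗ⇒≡ (any⁻ _ (patternsOf s) (Equivalence.from T-≡ matched))

rightComb-forbidden : ∀ s c d → ¬ T (admits (patternsOf s) (node c (leaf 1) (node d (leaf 2) (leaf 3))))
rightComb-forbidden false white white ()
rightComb-forbidden false white black ()
rightComb-forbidden false black white ()
rightComb-forbidden false black black ()
rightComb-forbidden true  white white ()
rightComb-forbidden true  white black ()
rightComb-forbidden true  black white ()
rightComb-forbidden true  black black ()

leftComb₁₂-admitted : ∀ s c d → T (admits (patternsOf s) (node c (node d (leaf 1) (leaf 2)) (leaf 3))) ⇔
                                (c ≡ colourOf s false × d ≡ colourOf s true)
leftComb₁₂-admitted s c d = mk⇔ (to s c d) (from s)
  where
  to : ∀ s c d → T (admits (patternsOf s) (node c (node d (leaf 1) (leaf 2)) (leaf 3))) →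
       c ≡ colourOf s false × d ≡ colourOf s true
  to false black white _ = refl , refl
  to true  white black _ = refl , refl
  to false white white ()
  to false white black ()
  to false black black ()
  to true  white white ()
  to true  black white ()
  to true  black black ()
  from : ∀ s {c d} → c ≡ colourOf s false × d ≡ colourOf s true →
         T (admits (patternsOf s) (node c (node d (leaf 1) (leaf 2)) (leaf 3)))
  from false (refl , refl) = _
  from true  (refl , refl) = _

leftComb₁₃-admitted : ∀ s c d → T (admits (patternsOf s) (node c (node d (leaf 1) (leaf 3)) (leaf 2))) ⇔
                                (c ≡ colourOf s true × d ≡ colourOf s false)
leftComb₁₃-admitted s c d = mk⇔ (to s c d) (from s)
  where
  to : ∀ s c d → T (admits (patternsOf s) (node c (node d (leaf 1) (leaf 3)) (leaf 2))) →
       c ≡ colourOf s true × d ≡ colourOf s false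
  to false white black _ = refl , refl
  to true  black white _ = refl , refl
  to false white white ()
  to false black white ()
  to false black black ()
  to true  white white ()
  to true  white black ()
  to true  black black ()
  from : ∀ s {c d} → c ≡ colourOf s true × d ≡ colourOf s false →
         T (admits (patternsOf s) (node c (node d (leaf 1) (leaf 3)) (leaf 2)))
  from false (refl , refl) = _
  from true  (refl , refl) = _

rightChild-node-forbidden : ∀ s c a d b₁ b₂ → T (ordered (node c a (node d b₁ b₂))) →
                            ¬ T (avoids (patternsOf s) (node c a (node d b₁ b₂)))
rightChild-node-forbidden s c a d b₁ b₂ o av with ordered-node⁻ c a (node d b₁ b₂) o
... | a<b , _ , ob with ordered-node⁻ d b₁ b₂ ob
...   | b₁<b₂ , _ = rightComb-forbidden s c d (subst (T ∘ admits (patternsOf s)) (st-rightComb a<b₁ b₁<b₂ c d) admitted)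
  where
  admitted : T (admits (patternsOf s) (st (node c (leaf (minLeaf a)) (node d (leaf (minLeaf b₁)) (leaf (minLeaf b₂))))))
  admitted = avoids⇒admits (patternsOf s) (node c a (node d b₁ b₂)) av (there (here refl))
  a<b₁ : minLeaf a < minLeaf b₁
  a<b₁ = subst (minLeaf a <_) (minLeaf-node d b₁ b₂ b₁<b₂) a<b

-- Right children of avoiding trees are leaves, so the last clause never matters.
spine : Tree → List ℕ
spine (leaf _)                = []
spine (node _ a (leaf r))     = pred r ∷ spine a
spine (node _ _ (node _ _ _)) = []

module _ (s : Bool) where

  comb : Bool → List ℕ → Tree
  comb b []       = leaf 1
  comb b (y ∷ ys) = node (colourOf s b) (comb (not b) ys) (leaf (suc y))

  minLeaf-comb : ∀ b xs → minLeaf (comb b xs) ≡ 1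
  minLeaf-comb b []       = refl
  minLeaf-comb b (y ∷ ys) rewrite minLeaf-comb (not b) ys = refl

  leaves-comb : ∀ b xs → leaves (comb b xs) ≡ 1 ∷ reverse (map suc xs)
  leaves-comb b []       = refl
  leaves-comb b (y ∷ ys) = begin
    leaves (comb (not b) ys) ++ suc y ∷ []   ≡⟨ cong (_++ suc y ∷ []) (leaves-comb (not b) ys) ⟩
    1 ∷ reverse (map suc ys) ++ suc y ∷ []   ≡⟨ cong (1 ∷_) (sym (unfold-reverse (suc y) (map suc ys))) ⟩
    1 ∷ reverse (map suc (y ∷ ys))           ∎

  ordered-comb : ∀ b xs → All (1 ≤_) xs → T (ordered (comb b xs))
  ordered-comb b []       _            = _
  ordered-comb b (y ∷ ys) (1≤y ∷ pos) rewrite minLeaf-comb (not b) ys =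
    Equivalence.from T-∧ (<⇒<ᵇ (s≤s 1≤y) , Equivalence.from T-∧ (ordered-comb (not b) ys pos , _))

  spine-comb : ∀ b xs → spine (comb b xs) ≡ xs
  spine-comb b []       = refl
  spine-comb b (y ∷ ys) = cong (y ∷_) (spine-comb (not b) ys)

  rootedSubtree-comb : ∀ {p} b y ys → p ∈ rootedSubtrees (comb b (y ∷ ys)) →
                       ∃[ q ] (q ∈ truncations (comb (not b) ys) × p ≡ node (colourOf s b) q (leaf (suc y)))
  rootedSubtree-comb b y ys p∈ with find (∈-concatMap⁻ (λ q → map (node (colourOf s b) q) (leaf (suc y) ∷ []))
                                                        {xs = truncations (comb (not b) ys)} p∈)
  ... | q , q∈ , here refl = q , q∈ , refl

  admits-zigzag-window : ∀ b {y y′} → 1 ≤ y → 1 ≤ y′ → T (inOrder b y y′) →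
    T (admits (patternsOf s) (st (node (colourOf s b) (node (colourOf s (not b)) (leaf 1) (leaf (suc y′))) (leaf (suc y)))))
  admits-zigzag-window true  1≤y _ y<y′ =
    subst (T ∘ admits (patternsOf s)) (sym (st-leftComb₁₃ (s≤s 1≤y) (s≤s (<ᵇ⇒< _ _ y<y′)) _ _))
      (Equivalence.from (leftComb₁₃-admitted s _ _) (refl , refl))
  admits-zigzag-window false _ 1≤y′ y′<y =
    subst (T ∘ admits (patternsOf s)) (sym (st-leftComb₁₂ (s≤s 1≤y′) (s≤s (<ᵇ⇒< _ _ y′<y)) _ _))
      (Equivalence.from (leftComb₁₂-admitted s _ _) (refl , refl))

  admits-rootedSubtree-comb : ∀ {p} b y ys → All (1 ≤_) (y ∷ ys) → T (zigzag b (y ∷ ys)) →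
                              p ∈ rootedSubtrees (comb b (y ∷ ys)) → T (admits (patternsOf s) (st p))
  admits-rootedSubtree-comb b y ys pos zz p∈ with rootedSubtree-comb b y ys p∈
  ... | q , here refl , refl = admits-size≢3 s (node (colourOf s b) q (leaf (suc y))) (λ ())
  admits-rootedSubtree-comb b y (y′ ∷ ys) (1≤y ∷ 1≤y′ ∷ _) zz p∈ | _ , there q∈ , refl
    with rootedSubtree-comb (not b) y′ ys q∈
  ... | leaf n , n∈ , refl =
    subst (T ∘ admits (patternsOf s) ∘ st ∘ window ∘ leaf)
          (sym (trans (leaf∈truncations (comb (not (not b)) ys) n∈) (minLeaf-comb (not (not b)) ys)))
          (admits-zigzag-window b 1≤y 1≤y′ (proj₁ (Equivalence.to (zigzag-∷∷ b) zz)))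
    where
    window : Tree → Tree
    window q = node (colourOf s b) (node (colourOf s (not b)) q (leaf (suc y′))) (leaf (suc y))
  ... | q@(node c a r) , _ , refl = admits-size≢3 s (window q) (>⇒≢ 3<size)
    where
    window : Tree → Tree
    window q = node (colourOf s b) (node (colourOf s (not b)) q (leaf (suc y′))) (leaf (suc y))
    3<size : 3 < size (window q)
    3<size = subst (4 ≤_) (sym (size-leftComb (colourOf s b) (colourOf s (not b)) q (suc y′) (suc y)))
                   (s≤s (s≤s (2≤size-node c a r)))

  comb-avoids : ∀ b xs → All (1 ≤_) xs → T (zigzag b xs) → T (avoids (patternsOf s) (comb b xs))
  comb-avoids b []       _   _  = _
  comb-avoids b (y ∷ ys) pos zz = all⁻ _ (++⁺ (All.tabulate (admits-rootedSubtree-comb b y ys pos zz))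
    (++⁺ (all⁺ _ _ (comb-avoids (not b) ys (All.tail pos) (zigzag-tail b y ys zz))) []))

  -- Avoiding trees are alternating combs

  -- The value on a leaf is irrelevant: comb b [] is leaf 1 for both b.
  topDirection : Tree → Bool
  topDirection (leaf _)     = true
  topDirection (node c _ _) = direction s c

  record Avoider (t : Tree) : Set where
    field
      isOrdered : T (ordered t)
      avoiding  : T (avoids (patternsOf s) t)
      distinct  : Unique (leaves t)
      positive  : All (1 ≤_) (leaves t)
      least     : minLeaf t ≡ 1

  open Avoider

  avoider-left : ∀ {c a b} → Avoider (node c a b) → Avoider a
  avoider-left {c} {a} {b} av = record
    { isOrdered = proj₁ (proj₂ (ordered-node⁻ c a b (isOrdered av)))
    ; avoiding  = all-anti-mono {xs = subtrees a} (admits (patternsOf s) ∘ st)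
                    (∈-++⁺ʳ (rootedSubtrees (node c a b)) ∘ ∈-++⁺ˡ) (avoiding av)
    ; distinct  = Unique-++⁻ˡ (leaves a) (distinct av)
    ; positive  = ++⁻ˡ (leaves a) (positive av)
    ; least     = trans (sym (minLeaf-node c a b (proj₁ (ordered-node⁻ c a b (isOrdered av))))) (least av)
    }

  zigzag-step : ∀ {c c′ a r′ r} → Avoider (node c (node c′ a (leaf r′)) (leaf r)) →
                direction s c′ ≡ not (direction s c) × T (inOrder (direction s c) (pred r) (pred r′))
  zigzag-step {c} {c′} {a} {r′} {r} av = by-order (<-cmp r′ r)
    where
    top : minLeaf (node c′ a (leaf r′)) < r × T (ordered (node c′ a (leaf r′))) × T (ordered (leaf r))
    top = ordered-node⁻ c (node c′ a (leaf r′)) (leaf r) (isOrdered av)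
    x<r′ : minLeaf a < r′
    x<r′ = proj₁ (ordered-node⁻ c′ a (leaf r′) (proj₁ (proj₂ top)))
    x<r : minLeaf a < r
    x<r = subst (_< r) (minLeaf-node c′ a (leaf r′) x<r′) (proj₁ top)
    1≤r′ : 1 ≤ r′
    1≤r′ = All.lookup (positive av) (∈-++⁺ˡ (∈-++⁺ʳ (leaves a) (here refl)))
    1≤r : 1 ≤ r
    1≤r = All.lookup (positive av) (∈-++⁺ʳ (leaves a ++ r′ ∷ []) (here refl))
    admitted : T (admits (patternsOf s) (st (node c (node c′ (leaf (minLeaf a)) (leaf r′)) (leaf r))))
    admitted = avoids⇒admits (patternsOf s) (node c (node c′ a (leaf r′)) (leaf r)) (avoiding av) (there (here refl))

    conclude : ∀ b → c ≡ colourOf s b × c′ ≡ colourOf s (not b) → T (inOrder b (pred r) (pred r′)) →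
               direction s c′ ≡ not (direction s c) × T (inOrder (direction s c) (pred r) (pred r′))
    conclude b (c≡ , c′≡) ordered-b =
      direction-c′ , subst (λ b → T (inOrder b (pred r) (pred r′))) (sym direction-c) ordered-b
      where
      direction-c : direction s c ≡ b
      direction-c = trans (cong (direction s) c≡) (direction-colourOf s b)
      direction-c′ : direction s c′ ≡ not (direction s c)
      direction-c′ = trans (cong (direction s) c′≡) (trans (direction-colourOf s (not b)) (cong not (sym direction-c)))

    by-order : Tri (r′ < r) (r′ ≡ r) (r < r′) →
               direction s c′ ≡ not (direction s c) × T (inOrder (direction s c) (pred r) (pred r′))
    by-order (tri< r′<r _ _) = conclude false
      (Equivalence.to (leftComb₁₂-admitted s c c′)
        (subst (T ∘ admits (patternsOf s)) (st-leftComb₁₂ x<r′ r′<r c c′) admitted))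
      (<⇒<ᵇ (pred-mono-< {{>-nonZero 1≤r′}} r′<r))
    by-order (tri≈ _ r′≡r _) =
      ⊥-elim (Unique-++⇒∉ (leaves a ++ r′ ∷ []) (distinct av) (∈-++⁺ʳ (leaves a) (here refl)) (here r′≡r))
    by-order (tri> _ _ r<r′) = conclude true
      (Equivalence.to (leftComb₁₃-admitted s c c′)
        (subst (T ∘ admits (patternsOf s)) (st-leftComb₁₃ x<r r<r′ c c′) admitted))
      (<⇒<ᵇ (pred-mono-< {{>-nonZero 1≤r}} r<r′))

  avoider-comb : ∀ t → Avoider t → t ≡ comb (topDirection t) (spine t) × T (zigzag (topDirection t) (spine t))
  avoider-comb (leaf _) av = cong leaf (least av) , _
  avoider-comb (node c a (node d b₁ b₂)) av =
    ⊥-elim (rightChild-node-forbidden s c a d b₁ b₂ (isOrdered av) (avoiding av))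
  avoider-comb (node c (node c′ a (node d b₁ b₂)) (leaf r)) av =
    ⊥-elim (rightChild-node-forbidden s c′ a d b₁ b₂ (isOrdered (avoider-left av)) (avoiding (avoider-left av)))
  avoider-comb (node c (leaf x) (leaf r)) av =
    node-cong (sym (colourOf-direction s c)) (cong leaf x≡1)
              (cong leaf (sym (suc-pred r {{>-nonZero (All.lookup (positive av) (there (here refl)))}}))) ,
    zigzag-[x] (direction s c) (pred r)
    where
    x≡1 : x ≡ 1
    x≡1 = trans (sym (minLeaf-node c (leaf x) (leaf r) (proj₁ (ordered-node⁻ c (leaf x) (leaf r) (isOrdered av))))) (least av)
  avoider-comb (node c (node c′ a (leaf r′)) (leaf r)) av
    with avoider-comb (node c′ a (leaf r′)) (avoider-left av) | zigzag-step av
  ... | lower≡ , lower-zigzag | direction-c′ , ordered-top =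
    node-cong (sym (colourOf-direction s c)) (trans lower≡ (cong (λ b → comb b (pred r′ ∷ spine a)) direction-c′))
              (cong leaf (sym (suc-pred r {{>-nonZero 1≤r}}))) ,
    Equivalence.from (zigzag-∷∷ (direction s c))
      (ordered-top , subst (λ b → T (zigzag b (pred r′ ∷ spine a))) direction-c′ lower-zigzag)
    where
    1≤r : 1 ≤ r
    1≤r = All.lookup (positive av) (∈-++⁺ʳ (leaves a ++ r′ ∷ []) (here refl))

  AvoidTree⇒Avoider : ∀ {m t} → T (isLT (suc m) t ∧ avoids (patternsOf s) t) → Avoider t
  AvoidTree⇒Avoider {m} {t} h with AvoidTree⁻ (patternsOf s) (suc m) t h
  ... | perm , o , av = record
    { isOrdered = o
    ; avoiding  = av
    ; distinct  = proj₁ (IsPerm⇒Unique×⊆oneTo perm)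
    ; positive  = IsPerm⇒positive perm
    ; least     = ≤-antisym (minLeaf-≤ t (proj₂ perm (∈-oneTo⁺ ≤-refl (s≤s z≤n))))
                            (All.lookup (IsPerm⇒positive perm) (minLeaf-∈ t))
    }

  AvoidTrees↔ZigzagPerms : ∀ m → 1 ≤ m → AvoidTrees (patternsOf s) (suc m) ↔ Σ Bool (λ b → ZigzagPerms b m)
  AvoidTrees↔ZigzagPerms m 1≤m = mk↔ₛ′ to from to∘from from∘to
    where
    to : AvoidTrees (patternsOf s) (suc m) → Σ Bool (λ b → ZigzagPerms b m)
    to (t , h) = topDirection t , spine t , Equivalence.from T-∧ (Equivalence.from isPermOf⇔IsPerm perm , proj₂ t-comb)
      where
      t-comb : t ≡ comb (topDirection t) (spine t) × T (zigzag (topDirection t) (spine t))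
      t-comb = avoider-comb t (AvoidTree⇒Avoider h)
      perm : IsPerm m (spine t)
      perm = Equivalence.to IsPerm-1∷reverse-map-suc
               (subst (IsPerm (suc m)) (trans (cong leaves (proj₁ t-comb)) (leaves-comb _ (spine t)))
                 (proj₁ (AvoidTree⁻ (patternsOf s) (suc m) t h)))

    from : Σ Bool (λ b → ZigzagPerms b m) → AvoidTrees (patternsOf s) (suc m)
    from (b , xs , h) with ZigzagPerms⁻ b m (xs , h)
    ... | perm , zz = comb b xs , Equivalence.from T-∧
      ( Equivalence.from T-∧ (Equivalence.from isPermOf⇔IsPerm perm′ , ordered-comb b xs (IsPerm⇒positive perm))
      , comb-avoids b xs (IsPerm⇒positive perm) zz )
      where
      perm′ : IsPerm (suc m) (leaves (comb b xs))
      perm′ = subst (IsPerm (suc m)) (sym (leaves-comb b xs)) (Equivalence.from IsPerm-1∷reverse-map-suc perm)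

    to∘from : ∀ z → to (from z) ≡ z
    to∘from (b , [] , h) = ⊥-elim (n≮0 (≤-trans 1≤m (≤-reflexive (sym (proj₁ (proj₁ (ZigzagPerms⁻ b m ([] , h))))))))
    to∘from (b , y ∷ ys , h) = Σ-ZigzagPerms-≡ (direction-colourOf s b) (spine-comb b (y ∷ ys))

    from∘to : ∀ z → from (to z) ≡ z
    from∘to (t , h) = Σ-T-≡ (sym (proj₁ (avoider-comb t (AvoidTree⇒Avoider h))))

-- Counting

Σ-Bool↔⊎ : {P : Bool → Set} → Σ Bool P ↔ (P true ⊎ P false)
Σ-Bool↔⊎ {P} = mk↔ₛ′ to from (λ { (inj₁ _) → refl ; (inj₂ _) → refl })
                              (λ { (true , _) → refl ; (false , _) → refl })
  where
  to : Σ Bool P → P true ⊎ P false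
  to (true  , p) = inj₁ p
  to (false , p) = inj₂ p
  from : P true ⊎ P false → Σ Bool P
  from (inj₁ p) = true  , p
  from (inj₂ p) = false , p

AvoidTrees↔Fin-2* : ∀ s m → 1 ≤ m → ∀ {a} → ZigzagPerms true m ↔ Fin a →
                    AvoidTrees (patternsOf s) (suc m) ↔ Fin (2 * a)
AvoidTrees↔Fin-2* s m 1≤m {a} up↔ =
  ↔-trans (AvoidTrees↔ZigzagPerms s m 1≤m) $
  ↔-trans Σ-Bool↔⊎ $
  ↔-trans (↔-refl ⊎-↔ ↔-sym (ZigzagPerms-up↔down m)) $
  ↔-trans (up↔ ⊎-↔ subst (λ k → ZigzagPerms true m ↔ Fin k) (sym (+-identityʳ a)) up↔) $
  ↔-sym +↔⊎

AvoidTrees-0↔Fin0 : ∀ ps → AvoidTrees ps 0 ↔ Fin 0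
AvoidTrees-0↔Fin0 ps = mk↔ₛ′ (⊥-elim ∘ no-tree) (λ ()) (λ ()) (⊥-elim ∘ no-tree)
  where
  no-tree : AvoidTrees ps 0 → ⊥
  no-tree (t , h) = n≮0 (subst (1 ≤_) size≡0 (1≤size t))
    where
    size≡0 : size t ≡ 0
    size≡0 = proj₁ (proj₁ (AvoidTree⁻ ps 0 t h))

IsPerm-1⇒leaf1 : ∀ t → IsPerm 1 (leaves t) → t ≡ leaf 1
IsPerm-1⇒leaf1 (leaf x) (_ , covered) with covered (here refl)
... | here 1≡x = cong leaf (sym 1≡x)
IsPerm-1⇒leaf1 (node c a b) (size≡1 , _) = ⊥-elim (<-irrefl (sym size≡1) (2≤size-node c a b))

AvoidTrees-1↔Fin1 : ∀ ps → AvoidTrees ps 1 ↔ Fin 1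
AvoidTrees-1↔Fin1 ps = ↔-trans (mk↔ₛ′ (λ _ → tt) (λ _ → leaf 1 , _) (λ _ → refl) only-leaf1) (↔-sym 1↔⊤)
  where
  only-leaf1 : ∀ z → (leaf 1 , _) ≡ z
  only-leaf1 (t , h) = Σ-T-≡ (sym (IsPerm-1⇒leaf1 t (proj₁ (AvoidTree⁻ ps 1 t h))))

count-AvoidTrees : ∀ m → 1 ≤ m → ∃[ a ] ((AltPerms m ↔ Fin a)
                     × (AvoidTrees patterns₁ (suc m) ↔ Fin (2 * a))
                     × (AvoidTrees patterns₂ (suc m) ↔ Fin (2 * a)))
count-AvoidTrees m 1≤m =
  let a , up↔ = finite-ZigzagPerms true m
  in  a , up↔ , AvoidTrees↔Fin-2* false m 1≤m up↔ , AvoidTrees↔Fin-2* true m 1≤m up↔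

wilf-equivalent : (l : ℕ) → ∃[ k ] ((AvoidTrees patterns₁ l ↔ Fin k) × (AvoidTrees patterns₂ l ↔ Fin k))
wilf-equivalent 0             = 0 , AvoidTrees-0↔Fin0 patterns₁ , AvoidTrees-0↔Fin0 patterns₂
wilf-equivalent 1             = 1 , AvoidTrees-1↔Fin1 patterns₁ , AvoidTrees-1↔Fin1 patterns₂
wilf-equivalent (suc m@(suc _)) =
  let a , _ , avoid₁↔ , avoid₂↔ = count-AvoidTrees m (s≤s z≤n) in 2 * a , avoid₁↔ , avoid₂↔

mainTheorem18 : ((l : ℕ) → ∃[ k ] ((AvoidTrees patterns₁ l ↔ Fin k) × (AvoidTrees patterns₂ l ↔ Fin k)))
    × ((n : ℕ) → 3 ≤ n → ∃[ a ] ((AltPerms (n ∸ 1) ↔ Fin a)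
        × (AvoidTrees patterns₁ n ↔ Fin (2 * a))
        × (AvoidTrees patterns₂ n ↔ Fin (2 * a))))
mainTheorem18 = wilf-equivalent , λ
  { (suc zero)        (s≤s ())
  ; (suc m@(suc _)) _ → count-AvoidTrees m (s≤s z≤n)
  }
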